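{- For every integer $n\ge 3$, $\mu_{\rm t}(L(K_n))={\rm ex}(n;C_4)$.
   Context: $L(K_n)$ is the line graph of the complete graph $K_n$. For a connected graph $H$ and $X\subseteq V(H)$, two vertices are $X$-visible if there is a shortest path between them whose internal vertices are not in $X$; $X$ is a total mutual-visibility set if every two vertices of $H$ are $X$-visible, and $\mu_{\rm t}(H)$ is the maximum cardinality of such a set. The Turán number ${\rm ex}(n;H')$ is the maximum number of edges of an $n$-vertex graph not containing $H'$ as a subgraph; $C_4$ is the $4$-cycle. -}

module Defs where

open import Data.Nat using (ℕ; zero; suc; _≤_)
open import Data.Fin using (Fin; _<_)
open import Data.Product using (Σ; _×_; _,_; proj₁; proj₂; ∃)
open import Data.Sum using (_⊎_)
open import Data.List using (List; []; _∷_; length)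
open import Data.List.Relation.Unary.All using (All)
open import Data.List.Relation.Unary.Unique.Propositional using (Unique)
open import Data.List.Membership.Propositional using (_∈_)
open import Relation.Binary.PropositionalEquality using (_≡_; _≢_)
open import Relation.Nullary using (¬_)

data Walk {V : Set} (Adj : V → V → Set) : V → V → ℕ → Set where
  nil  : ∀ {u} → Walk Adj u u 0
  cons : ∀ {u w v k} → Adj u w → Walk Adj w v k → Walk Adj u v (suc k)

interior : ∀ {V} {Adj : V → V → Set} {u v k} → Walk Adj u v k → List V
interior nil = []
interior (cons a nil) = []
interior (cons {w = w} a (cons b p)) = w ∷ interior (cons b p)

IsShortest : ∀ {V} (Adj : V → V → Set) {u v k} → Walk Adj u v k → Set
IsShortest {V} Adj {u} {v} {k} p = ∀ k' → Walk Adj u v k' → k ≤ k'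

Visible : ∀ {V} (Adj : V → V → Set) (X : List V) → V → V → Set
Visible Adj X u v =
  Σ ℕ λ k → Σ (Walk Adj u v k) λ p →
    IsShortest Adj p × All (λ x → ¬ (x ∈ X)) (interior p)

IsTotalMutVis : ∀ {V} (Adj : V → V → Set) → List V → Set
IsTotalMutVis {V} Adj X = ∀ (u v : V) → Visible Adj X u v

IsMuT : ∀ {V} (Adj : V → V → Set) → ℕ → Set
IsMuT {V} Adj m =
  (Σ (List V) λ X → Unique X × IsTotalMutVis Adj X × length X ≡ m)
  × (∀ (X : List V) → Unique X → IsTotalMutVis Adj X → length X ≤ m)

Edge : ℕ → Set
Edge n = Σ (Fin n × Fin n) λ p → proj₁ p < proj₂ p

ShareEnd : ∀ {n} → Edge n → Edge n → Set
ShareEnd ((i , j) , _) ((k , l) , _) = i ≡ k ⊎ i ≡ l ⊎ j ≡ k ⊎ j ≡ l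

LKAdj : ∀ n → Edge n → Edge n → Set
LKAdj n e f = (proj₁ e ≢ proj₁ f) × ShareEnd e f

-- A simple graph on vertex set Fin n is a duplicate-free list of edges of K_n;
-- its number of edges is the length of the list.

HasEdge : ∀ {n} → List (Edge n) → Fin n → Fin n → Set
HasEdge {n} E i j =
  Σ (Edge n) λ e → e ∈ E ×
    ((proj₁ (proj₁ e) ≡ i × proj₂ (proj₁ e) ≡ j)
     ⊎ (proj₁ (proj₁ e) ≡ j × proj₂ (proj₁ e) ≡ i))

ContainsC4 : ∀ {n} → List (Edge n) → Set
ContainsC4 {n} E =
  Σ (Fin n) λ a → Σ (Fin n) λ b → Σ (Fin n) λ c → Σ (Fin n) λ d →
    (a ≢ b × a ≢ c × a ≢ d × b ≢ c × b ≢ d × c ≢ d)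
    × HasEdge E a b × HasEdge E b c × HasEdge E c d × HasEdge E d a

IsExC4 : ℕ → ℕ → Set
IsExC4 n m =
  (Σ (List (Edge n)) λ E → Unique E × ¬ ContainsC4 E × length E ≡ m)
  × (∀ (E : List (Edge n)) → Unique E → ¬ ContainsC4 E → length E ≤ m)

-- A set X of edges of K_n is a total mutual-visibility set of L(K_n) exactly when
-- X, read as a graph on Fin n, has no 4-cycle.  Two edges sharing an endpoint are
-- adjacent in L(K_n); two disjoint edges ac and bd are at distance 2, and the
-- middle vertices of their shortest paths are precisely the four edges ab, ad, cb,
-- cd, i.e. the cross edges of the 4-cycle a b c d.  So ac and bd fail to be
-- X-visible iff all four cross edges lie in X, i.e. iff X contains that 4-cycle.
-- Hence the two maximisation problems have the same feasible sets, and a largest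
-- feasible set exists because there are only finitely many sets of edges.

module Submission where

open import Defs
open import Data.Nat using (ℕ; _≤_; z≤n; s≤s)
open import Data.Nat.Properties using (≤-trans; ≤-totalOrder)
open import Data.Fin using (Fin; zero; suc; _<_)
open import Data.Fin.Properties using (_≟_; _<?_; <-irrelevant; <-cmp; <-asym; <⇒≢; any?; injective⇒≤)
open import Data.Product using (Σ; _×_; _,_; proj₁; proj₂)
open import Data.Product.Properties using (≡-dec)
open import Data.Sum using (_⊎_; inj₁; inj₂)
open import Data.Empty using (⊥-elim)
open import Data.List using (List; []; _∷_; [_]; length; map; _++_; filter; deduplicate; lookup; concatMap; allFin)
open import Data.List.Extrema ≤-totalOrder using (argmax; argmax-all; f[xs]≤f[argmax])
open import Data.List.Relation.Unary.Any using (here; index)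
import Data.List.Relation.Unary.Any as Any
open import Data.List.Relation.Unary.Any.Properties using (lookup-index)
open import Data.List.Relation.Unary.All using ([]; _∷_)
import Data.List.Relation.Unary.All as All
open import Data.List.Relation.Unary.All.Properties using (all-filter)
open import Data.List.Relation.Unary.AllPairs using ([]; _∷_)
open import Data.List.Relation.Unary.Unique.Propositional using (Unique)
open import Data.List.Relation.Unary.Unique.Propositional.Properties using (filter⁺)
open import Data.List.Relation.Unary.Unique.DecPropositional.Properties using (deduplicate-!)
open import Data.List.Relation.Binary.Subset.Propositional using (_⊆_)
open import Data.List.Membership.Propositional using (_∈_; find; lose)
open import Data.List.Membership.Propositional.Properties
  using (∈-map⁺; ∈-++⁺ˡ; ∈-++⁺ʳ; ∈-filter⁺; ∈-filter⁻; ∈-lookup; ∈-deduplicate⁺; ∈-concatMap⁺; ∈-allFin)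
open import Function using (_∘_)
open import Level using (Level)
open import Relation.Binary.PropositionalEquality using (_≡_; _≢_; ≢-sym; refl; sym; trans; cong; subst; subst₂; module ≡-Reasoning)
open import Relation.Binary.Definitions using (DecidableEquality; tri<; tri≈; tri>)
open import Relation.Nullary using (¬_; Dec; yes; no)
open import Relation.Nullary.Decidable using (_×-dec_; _⊎-dec_; ¬?; map′)
open import Relation.Unary using (Pred; Decidable)

private
  variable
    a p : Level

module _ {A : Set a} where

  sublists : List A → List (List A)
  sublists [] = [ [] ]
  sublists (x ∷ xs) = map (x ∷_) (sublists xs) ++ sublists xs

  filter∈sublists : {P : Pred A p} (P? : Decidable P) (xs : List A) → filter P? xs ∈ sublists xs
  filter∈sublists P? [] = here refl
  filter∈sublists P? (x ∷ xs) with P? x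
  ... | yes _ = ∈-++⁺ˡ (∈-map⁺ (x ∷_) (filter∈sublists P? xs))
  ... | no _ = ∈-++⁺ʳ (map (x ∷_) (sublists xs)) (filter∈sublists P? xs)

  Unique⇒lookup-injective : {xs : List A} → Unique xs → ∀ i j → lookup xs i ≡ lookup xs j → i ≡ j
  Unique⇒lookup-injective (_ ∷ _) zero zero _ = refl
  Unique⇒lookup-injective (x∉xs ∷ _) zero (suc j) eq = ⊥-elim (All.lookup x∉xs (∈-lookup j) eq)
  Unique⇒lookup-injective (x∉xs ∷ _) (suc i) zero eq = ⊥-elim (All.lookup x∉xs (∈-lookup i) (sym eq))
  Unique⇒lookup-injective (_ ∷ uniq) (suc i) (suc j) eq = cong suc (Unique⇒lookup-injective uniq i j eq)

  Unique⇒length≤ : {xs ys : List A} → Unique xs → xs ⊆ ys → length xs ≤ length ys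
  Unique⇒length≤ {xs} {ys} uniq xs⊆ys = injective⇒≤ λ {i} {j} eq →
    Unique⇒lookup-injective uniq i j (begin
      lookup xs i                            ≡⟨ lookup-index (xs⊆ys (∈-lookup i)) ⟩
      lookup ys (index (xs⊆ys (∈-lookup i))) ≡⟨ cong (lookup ys) eq ⟩
      lookup ys (index (xs⊆ys (∈-lookup j))) ≡⟨ sym (lookup-index (xs⊆ys (∈-lookup j))) ⟩
      lookup xs j                            ∎)
    where open ≡-Reasoning

  -- A feasible ys is dominated by its trace, the sublist of a duplicate-free
  -- enumeration of A consisting of the elements of ys; traces range over a finite list.
  largest-exists : {P : Pred (List A) p} → DecidableEquality A →
    {xs : List A} → (∀ x → x ∈ xs) →
    Decidable P → P [] → (∀ {ys zs} → ys ⊆ zs → P zs → P ys) →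
    Σ (List A) λ S → Unique S × P S × (∀ ys → Unique ys → P ys → length ys ≤ length S)
  largest-exists {P = P} _≟ᴬ_ {xs} ∈xs P? P[] P-⊆ = S , proj₁ S-feasible , proj₂ S-feasible , S-largest
    where
      open import Data.List.Membership.DecPropositional _≟ᴬ_ using (_∈?_)
      open import Data.List.Relation.Unary.Unique.DecPropositional _≟ᴬ_ using (unique?)

      universe : List A
      universe = deduplicate _≟ᴬ_ xs

      Feasible : Pred (List A) _
      Feasible ys = Unique ys × P ys

      feasible? : Decidable Feasible
      feasible? ys = unique? ys ×-dec P? ys

      candidates : List (List A)
      candidates = filter feasible? (sublists universe)

      S : List A
      S = argmax length [] candidates

      S-feasible : Feasible S
      S-feasible = argmax-all length {P = Feasible} ([] , P[]) (all-filter feasible? (sublists universe))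

      S-largest : ∀ ys → Unique ys → P ys → length ys ≤ length S
      S-largest ys uniq Pys =
        ≤-trans (Unique⇒length≤ uniq ys⊆trace) (All.lookup (f[xs]≤f[argmax] {f = length} [] candidates) trace∈candidates)
        where
          trace : List A
          trace = filter (_∈? ys) universe

          ys⊆trace : ys ⊆ trace
          ys⊆trace y∈ys = ∈-filter⁺ (_∈? ys) (∈-deduplicate⁺ _≟ᴬ_ (∈xs _)) y∈ys

          trace∈candidates : trace ∈ candidates
          trace∈candidates = ∈-filter⁺ feasible? (filter∈sublists (_∈? ys) universe)
            (filter⁺ (_∈? ys) (deduplicate-! _≟ᴬ_ xs) , P-⊆ (λ y∈trace → proj₂ (∈-filter⁻ (_∈? ys) {xs = universe} y∈trace)) Pys)

module _ {V : Set} {Adj : V → V → Set} where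

  walk-length≥1 : ∀ {u v k} → u ≢ v → Walk Adj u v k → 1 ≤ k
  walk-length≥1 u≢v nil = ⊥-elim (u≢v refl)
  walk-length≥1 _ (cons _ _) = s≤s z≤n

  walk-length≥2 : ∀ {u v k} → u ≢ v → ¬ Adj u v → Walk Adj u v k → 2 ≤ k
  walk-length≥2 u≢v _ nil = ⊥-elim (u≢v refl)
  walk-length≥2 _ ¬uv (cons uv nil) = ⊥-elim (¬uv uv)
  walk-length≥2 _ _ (cons _ (cons _ _)) = s≤s (s≤s z≤n)

  visible-refl : ∀ X u → Visible Adj X u u
  visible-refl X u = 0 , nil , (λ _ _ → z≤n) , []

  visible-adjacent : ∀ X {u v} → u ≢ v → Adj u v → Visible Adj X u v
  visible-adjacent X u≢v uv = 1 , cons uv nil , (λ _ → walk-length≥1 u≢v) , []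

  visible-via : ∀ X {u w v} → u ≢ v → ¬ Adj u v → Adj u w → Adj w v → ¬ w ∈ X → Visible Adj X u v
  visible-via X u≢v ¬uv uw wv w∉X = 2 , cons uw (cons wv nil) , (λ _ → walk-length≥2 u≢v ¬uv) , w∉X ∷ []

  -- At distance 2 every shortest path has exactly one internal vertex.
  visible-distance-2⇒middle∉ : ∀ X {u w v} → u ≢ v → ¬ Adj u v → Adj u w → Adj w v →
    Visible Adj X u v → Σ V λ w′ → Adj u w′ × Adj w′ v × ¬ w′ ∈ X
  visible-distance-2⇒middle∉ _ u≢v _ _ _ (_ , nil , _) = ⊥-elim (u≢v refl)
  visible-distance-2⇒middle∉ _ _ ¬uv _ _ (_ , cons uv nil , _) = ⊥-elim (¬uv uv)
  visible-distance-2⇒middle∉ _ _ _ _ _ (_ , cons uw′ (cons w′v nil) , _ , w′∉X ∷ []) = _ , uw′ , w′v , w′∉X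
  visible-distance-2⇒middle∉ _ _ _ uw wv (_ , cons _ (cons _ (cons _ _)) , shortest , _)
    with shortest 2 (cons uw (cons wv nil))
  ... | s≤s (s≤s ())

module _ {n : ℕ} where

  lo hi : Edge n → Fin n
  lo e = proj₁ (proj₁ e)
  hi e = proj₂ (proj₁ e)

  infix 4 _∋_
  data _∋_ (e : Edge n) : Fin n → Set where
    lo∋ : e ∋ lo e
    hi∋ : e ∋ hi e

  edge-≡ : {e f : Edge n} → lo e ≡ lo f → hi e ≡ hi f → e ≡ f
  edge-≡ {(i , j) , i<j} {(.i , .j) , i<j′} refl refl = cong ((i , j) ,_) (<-irrelevant i<j i<j′)

  _≟ᴱ_ : DecidableEquality (Edge n)
  _≟ᴱ_ = ≡-dec (≡-dec _≟_ _≟_) (λ p q → yes (<-irrelevant p q))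

  endpoints : {e : Edge n} {x y : Fin n} → x ≢ y → e ∋ x → e ∋ y →
    (lo e ≡ x × hi e ≡ y) ⊎ (lo e ≡ y × hi e ≡ x)
  endpoints x≢y lo∋ lo∋ = ⊥-elim (x≢y refl)
  endpoints _ lo∋ hi∋ = inj₁ (refl , refl)
  endpoints _ hi∋ lo∋ = inj₂ (refl , refl)
  endpoints x≢y hi∋ hi∋ = ⊥-elim (x≢y refl)

  endpoint-cases : {e : Edge n} {x y z : Fin n} → x ≢ y → e ∋ x → e ∋ y → e ∋ z → z ≡ x ⊎ z ≡ y
  endpoint-cases x≢y lo∋ lo∋ _ = ⊥-elim (x≢y refl)
  endpoint-cases x≢y hi∋ hi∋ _ = ⊥-elim (x≢y refl)
  endpoint-cases _ lo∋ hi∋ lo∋ = inj₁ refl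
  endpoint-cases _ lo∋ hi∋ hi∋ = inj₂ refl
  endpoint-cases _ hi∋ lo∋ lo∋ = inj₂ refl
  endpoint-cases _ hi∋ lo∋ hi∋ = inj₁ refl

  -- Opposite orientations would give both lo < hi and hi < lo.
  edge-determined : {e f : Edge n} {x y : Fin n} → x ≢ y → e ∋ x → e ∋ y → f ∋ x → f ∋ y → e ≡ f
  edge-determined {e} {f} x≢y ex ey fx fy with endpoints x≢y ex ey | endpoints x≢y fx fy
  ... | inj₁ (a , b) | inj₁ (c , d) = edge-≡ (trans a (sym c)) (trans b (sym d))
  ... | inj₂ (a , b) | inj₂ (c , d) = edge-≡ (trans a (sym c)) (trans b (sym d))
  ... | inj₁ (a , b) | inj₂ (c , d) = ⊥-elim (<-asym (subst₂ _<_ (trans a (sym d)) (trans b (sym c)) (proj₂ e)) (proj₂ f))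
  ... | inj₂ (a , b) | inj₁ (c , d) = ⊥-elim (<-asym (subst₂ _<_ (trans a (sym d)) (trans b (sym c)) (proj₂ e)) (proj₂ f))

  edgeBetween : {x y : Fin n} → x ≢ y → Σ (Edge n) λ e → e ∋ x × e ∋ y
  edgeBetween {x} {y} x≢y with <-cmp x y
  ... | tri< x<y _ _ = ((x , y) , x<y) , lo∋ , hi∋
  ... | tri≈ _ x≡y _ = ⊥-elim (x≢y x≡y)
  ... | tri> _ _ y<x = ((y , x) , y<x) , hi∋ , lo∋

  ∋-distinguishes : {e f : Edge n} {z : Fin n} → e ∋ z → ¬ f ∋ z → e ≢ f
  ∋-distinguishes ez ¬fz refl = ¬fz ez

  shareEnd⁺ : {e f : Edge n} {z : Fin n} → e ∋ z → f ∋ z → ShareEnd e f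
  shareEnd⁺ {(_ , _) , _} {(_ , _) , _} lo∋ lo∋ = inj₁ refl
  shareEnd⁺ {(_ , _) , _} {(_ , _) , _} lo∋ hi∋ = inj₂ (inj₁ refl)
  shareEnd⁺ {(_ , _) , _} {(_ , _) , _} hi∋ lo∋ = inj₂ (inj₂ (inj₁ refl))
  shareEnd⁺ {(_ , _) , _} {(_ , _) , _} hi∋ hi∋ = inj₂ (inj₂ (inj₂ refl))

  shareEnd⁻ : {e f : Edge n} → ShareEnd e f → Σ (Fin n) λ z → e ∋ z × f ∋ z
  shareEnd⁻ {(_ , _) , _} {(_ , _) , _} (inj₁ refl) = _ , lo∋ , lo∋
  shareEnd⁻ {(_ , _) , _} {(_ , _) , _} (inj₂ (inj₁ refl)) = _ , lo∋ , hi∋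
  shareEnd⁻ {(_ , _) , _} {(_ , _) , _} (inj₂ (inj₂ (inj₁ refl))) = _ , hi∋ , lo∋
  shareEnd⁻ {(_ , _) , _} {(_ , _) , _} (inj₂ (inj₂ (inj₂ refl))) = _ , hi∋ , hi∋

  shareEnd? : (e f : Edge n) → Dec (ShareEnd e f)
  shareEnd? ((i , j) , _) ((k , l) , _) = i ≟ k ⊎-dec i ≟ l ⊎-dec j ≟ k ⊎-dec j ≟ l

  adjacent : {e f : Edge n} → e ≢ f → ShareEnd e f → LKAdj n e f
  adjacent e≢f share = (λ eq → e≢f (edge-≡ (cong proj₁ eq) (cong proj₂ eq))) , share

  hasEdge⁺ : {X : List (Edge n)} {e : Edge n} {x y : Fin n} → e ∈ X → x ≢ y → e ∋ x → e ∋ y → HasEdge X x y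
  hasEdge⁺ {e = e} e∈X x≢y ex ey with endpoints x≢y ex ey
  ... | inj₁ ends = e , e∈X , inj₁ ends
  ... | inj₂ ends = e , e∈X , inj₂ ends

  hasEdge⁻ : {X : List (Edge n)} {x y : Fin n} → HasEdge X x y → Σ (Edge n) λ e → e ∈ X × e ∋ x × e ∋ y
  hasEdge⁻ (e , e∈X , inj₁ (refl , refl)) = e , e∈X , lo∋ , hi∋
  hasEdge⁻ (e , e∈X , inj₂ (refl , refl)) = e , e∈X , hi∋ , lo∋

  hasEdge-sym : {X : List (Edge n)} {x y : Fin n} → HasEdge X x y → HasEdge X y x
  hasEdge-sym (e , e∈X , inj₁ ends) = e , e∈X , inj₂ ends
  hasEdge-sym (e , e∈X , inj₂ ends) = e , e∈X , inj₁ ends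

  Disjoint : Edge n → Edge n → Set
  Disjoint e f = ∀ {z} → e ∋ z → ¬ f ∋ z

  disjoint⇒≢ : {e f : Edge n} → Disjoint e f → e ≢ f
  disjoint⇒≢ disj refl = disj lo∋ lo∋

  disjoint⇒¬adjacent : {e f : Edge n} → Disjoint e f → ¬ LKAdj n e f
  disjoint⇒¬adjacent disj (_ , share) = let (_ , ez , fz) = shareEnd⁻ share in disj ez fz

  disjoint⇒ends-≢ : {e f : Edge n} {x y : Fin n} → Disjoint e f → e ∋ x → f ∋ y → x ≢ y
  disjoint⇒ends-≢ disj ex fy refl = disj ex fy

  Crosses : Edge n → Edge n → Edge n → Set
  Crosses u v w = Σ (Fin n) λ x → Σ (Fin n) λ y → u ∋ x × v ∋ y × w ∋ x × w ∋ y

  crossing-path : {u v w : Edge n} → Disjoint u v → Crosses u v w → LKAdj n u w × LKAdj n w v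
  crossing-path disj (x , y , ux , vy , wx , wy) =
    adjacent (≢-sym (∋-distinguishes wy λ uy → disj uy vy)) (shareEnd⁺ ux wx) ,
    adjacent (∋-distinguishes wx (disj ux)) (shareEnd⁺ wy vy)

  crossing∉⇒visible : ∀ X {u v w} → Disjoint u v → Crosses u v w → ¬ w ∈ X → Visible (LKAdj n) X u v
  crossing∉⇒visible X disj cross w∉X =
    let (uw , wv) = crossing-path disj cross
    in visible-via X (disjoint⇒≢ disj) (disjoint⇒¬adjacent disj) uw wv w∉X

  visible⇒crossing∉ : ∀ X {u v} → Disjoint u v → Visible (LKAdj n) X u v →
    Σ (Edge n) λ w → Crosses u v w × ¬ w ∈ X
  visible⇒crossing∉ X {u} {v} disj vis =
    let (w₀ , w₀x , w₀y) = edgeBetween (disjoint⇒ends-≢ disj lo∋ lo∋)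
        (uw₀ , w₀v) = crossing-path disj (_ , _ , lo∋ , lo∋ , w₀x , w₀y)
        (w , uw , wv , w∉X) =
          visible-distance-2⇒middle∉ X {u} {w₀} {v} (disjoint⇒≢ disj) (disjoint⇒¬adjacent disj) uw₀ w₀v vis
        (x , ux , wx) = shareEnd⁻ (proj₂ uw)
        (y , wy , vy) = shareEnd⁻ (proj₂ wv)
    in w , (x , y , ux , vy , wx , wy) , w∉X

  module _ (X : List (Edge n)) where

    open import Data.List.Membership.DecPropositional _≟ᴱ_ using (_∈?_)

    module _ {u v : Edge n} (disj : Disjoint u v) where

      private
        cross : ∀ {x y} → u ∋ x → v ∋ y → Σ (Edge n) λ w → w ∋ x × w ∋ y
        cross ux vy = edgeBetween (disjoint⇒ends-≢ disj ux vy)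

        a≢b : lo u ≢ hi u
        a≢b = <⇒≢ (proj₂ u)
        c≢d : lo v ≢ hi v
        c≢d = <⇒≢ (proj₂ v)
        a≢c : lo u ≢ lo v
        a≢c = disjoint⇒ends-≢ disj lo∋ lo∋
        a≢d : lo u ≢ hi v
        a≢d = disjoint⇒ends-≢ disj lo∋ hi∋
        b≢c : hi u ≢ lo v
        b≢c = disjoint⇒ends-≢ disj hi∋ lo∋
        b≢d : hi u ≢ hi v
        b≢d = disjoint⇒ends-≢ disj hi∋ hi∋

      -- If all four cross edges of u = ab and v = cd lie in X, then a c b d is a 4-cycle in X.
      C4-free⇒crossing∉ : ¬ ContainsC4 X → Σ (Edge n) λ w → Crosses u v w × ¬ w ∈ X
      C4-free⇒crossing∉ C4-free with cross lo∋ lo∋ | cross lo∋ hi∋ | cross hi∋ lo∋ | cross hi∋ hi∋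
      ... | w₁ , w₁a , w₁c | w₂ , w₂a , w₂d | w₃ , w₃b , w₃c | w₄ , w₄b , w₄d
        with w₁ ∈? X | w₂ ∈? X | w₃ ∈? X | w₄ ∈? X
      ... | no w₁∉X | _ | _ | _ = w₁ , (_ , _ , lo∋ , lo∋ , w₁a , w₁c) , w₁∉X
      ... | yes _ | no w₂∉X | _ | _ = w₂ , (_ , _ , lo∋ , hi∋ , w₂a , w₂d) , w₂∉X
      ... | yes _ | yes _ | no w₃∉X | _ = w₃ , (_ , _ , hi∋ , lo∋ , w₃b , w₃c) , w₃∉X
      ... | yes _ | yes _ | yes _ | no w₄∉X = w₄ , (_ , _ , hi∋ , hi∋ , w₄b , w₄d) , w₄∉X
      ... | yes w₁∈X | yes w₂∈X | yes w₃∈X | yes w₄∈X = ⊥-elim (C4-free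
            (lo u , lo v , hi u , hi v , (a≢c , a≢b , a≢d , ≢-sym b≢c , c≢d , b≢d) ,
             hasEdge⁺ w₁∈X a≢c w₁a w₁c , hasEdge⁺ w₃∈X (≢-sym b≢c) w₃c w₃b ,
             hasEdge⁺ w₄∈X b≢d w₄b w₄d , hasEdge⁺ w₂∈X (≢-sym a≢d) w₂d w₂a))

    C4-free⇒totalMutVis : ¬ ContainsC4 X → IsTotalMutVis (LKAdj n) X
    C4-free⇒totalMutVis C4-free u v with u ≟ᴱ v
    ... | yes refl = visible-refl X u
    ... | no u≢v with shareEnd? u v
    ...   | yes share = visible-adjacent X u≢v (adjacent u≢v share)
    ...   | no ¬share =
      let disj : Disjoint u v
          disj uz vz = ¬share (shareEnd⁺ uz vz)
          (w , cross , w∉X) = C4-free⇒crossing∉ disj C4-free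
      in crossing∉⇒visible X disj cross w∉X

    -- The diagonals u = ac and v = bd of a 4-cycle a b c d in X are disjoint, and
    -- every cross edge of them is a side of the cycle.
    totalMutVis⇒C4-free : IsTotalMutVis (LKAdj n) X → ¬ ContainsC4 X
    totalMutVis⇒C4-free tmv (a , b , c , d , (a≢b , a≢c , a≢d , b≢c , b≢d , c≢d) , ab , bc , cd , da) =
      let (u , ua , uc) = edgeBetween a≢c
          (v , vb , vd) = edgeBetween b≢d
          onU : ∀ {z} → u ∋ z → z ≡ a ⊎ z ≡ c
          onU = endpoint-cases a≢c ua uc
          onV : ∀ {z} → v ∋ z → z ≡ b ⊎ z ≡ d
          onV = endpoint-cases b≢d vb vd
          disj : Disjoint u v
          disj uz vz = cross-≢ (onU uz) (onV vz) refl
          (w , (x , y , ux , vy , wx , wy) , w∉X) = visible⇒crossing∉ X disj (tmv u v)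
          x≢y : x ≢ y
          x≢y = cross-≢ (onU ux) (onV vy)
          (e , e∈X , ex , ey) = hasEdge⁻ (side (onU ux) (onV vy))
      in w∉X (subst (_∈ X) (edge-determined x≢y ex ey wx wy) e∈X)
      where
        cross-≢ : ∀ {x y} → x ≡ a ⊎ x ≡ c → y ≡ b ⊎ y ≡ d → x ≢ y
        cross-≢ (inj₁ refl) (inj₁ refl) = a≢b
        cross-≢ (inj₁ refl) (inj₂ refl) = a≢d
        cross-≢ (inj₂ refl) (inj₁ refl) = ≢-sym b≢c
        cross-≢ (inj₂ refl) (inj₂ refl) = c≢d

        side : ∀ {x y} → x ≡ a ⊎ x ≡ c → y ≡ b ⊎ y ≡ d → HasEdge X x y
        side (inj₁ refl) (inj₁ refl) = ab
        side (inj₁ refl) (inj₂ refl) = hasEdge-sym da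
        side (inj₂ refl) (inj₁ refl) = hasEdge-sym bc
        side (inj₂ refl) (inj₂ refl) = cd

  edgesBetween : (i j : Fin n) → List (Edge n)
  edgesBetween i j with i <? j
  ... | yes i<j = [ (i , j) , i<j ]
  ... | no _ = []

  ∈-edgesBetween : {i j : Fin n} (i<j : i < j) → ((i , j) , i<j) ∈ edgesBetween i j
  ∈-edgesBetween {i} {j} i<j with i <? j
  ... | yes i<j′ = here (edge-≡ refl refl)
  ... | no i≮j = ⊥-elim (i≮j i<j)

  edgesFrom : Fin n → List (Edge n)
  edgesFrom i = concatMap (edgesBetween i) (allFin n)

  allEdges : List (Edge n)
  allEdges = concatMap edgesFrom (allFin n)

  ∈-allEdges : (e : Edge n) → e ∈ allEdges
  ∈-allEdges ((i , j) , i<j) =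
    ∈-concatMap⁺ edgesFrom (lose (∈-allFin i) (∈-concatMap⁺ (edgesBetween i) (lose (∈-allFin j) (∈-edgesBetween i<j))))

  hasEdge? : (X : List (Edge n)) (x y : Fin n) → Dec (HasEdge X x y)
  hasEdge? X x y = map′ find (λ (e , e∈X , ends) → lose e∈X ends)
    (Any.any? (λ e → ((lo e ≟ x) ×-dec (hi e ≟ y)) ⊎-dec ((lo e ≟ y) ×-dec (hi e ≟ x))) X)

  containsC4? : (X : List (Edge n)) → Dec (ContainsC4 X)
  containsC4? X = any? λ a → any? λ b → any? λ c → any? λ d →
    (¬? (a ≟ b) ×-dec ¬? (a ≟ c) ×-dec ¬? (a ≟ d) ×-dec ¬? (b ≟ c) ×-dec ¬? (b ≟ d) ×-dec ¬? (c ≟ d))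
    ×-dec hasEdge? X a b ×-dec hasEdge? X b c ×-dec hasEdge? X c d ×-dec hasEdge? X d a

  containsC4-mono : {X Y : List (Edge n)} → X ⊆ Y → ContainsC4 X → ContainsC4 Y
  containsC4-mono X⊆Y (a , b , c , d , distinct , (e₁ , m₁ , q₁) , (e₂ , m₂ , q₂) , (e₃ , m₃ , q₃) , (e₄ , m₄ , q₄)) =
    a , b , c , d , distinct , (e₁ , X⊆Y m₁ , q₁) , (e₂ , X⊆Y m₂ , q₂) , (e₃ , X⊆Y m₃ , q₃) , (e₄ , X⊆Y m₄ , q₄)

  ¬containsC4[] : ¬ ContainsC4 {n} []
  ¬containsC4[] (_ , _ , _ , _ , _ , (_ , () , _) , _)

theorem3p7 : ∀ (n : ℕ) → 3 ≤ n →
    Σ ℕ λ m → IsMuT (LKAdj n) m × IsExC4 n m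
theorem3p7 n _ =
  let (S , S-unique , S-C4-free , S-largest) =
        largest-exists {P = λ X → ¬ ContainsC4 {n} X} _≟ᴱ_ ∈-allEdges (¬? ∘ containsC4?) ¬containsC4[]
          (λ X⊆Y Y-C4-free → Y-C4-free ∘ containsC4-mono X⊆Y)
  in length S
   , ((S , S-unique , C4-free⇒totalMutVis S S-C4-free , refl) ,
      λ X X-unique X-tmv → S-largest X X-unique (totalMutVis⇒C4-free X X-tmv))
   , ((S , S-unique , S-C4-free , refl) , S-largest)
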